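{- Let $P=(X,\prec)$ be a poset on $|X|=n$ elements. Fix elements $u_1\prec\dots\prec u_k$ of $X$ and integers $1\le a_1<\dots<a_k\le n$, and let $\mathcal E(P,\mathbf u,\mathbf a)$ be the set of linear extensions $f$ of $P$ such that $f(u_i)=a_i$ for all $1\le i\le k$. Then $|\mathcal E(P,\mathbf u,\mathbf a)|>0$ if and only if $$\ell(u_i)\le a_i\ \text{ and }\ b(u_i)\le n-a_i+1\quad\text{for all }1\le i\le k,$$ and $$a_j-a_i>h(u_i,u_j)\quad\text{for all }1\le i<j\le k.$$
   Context: A linear extension of $P$ is a bijection $f:X\to[n]$ with $f(x)<f(y)$ whenever $x\prec y$. For $x\in X$, $\ell(x):=|\{y\in X:y\preccurlyeq x\}|$ and $b(x):=|\{y\in X: y\succcurlyeq x\}|$. For $x\prec y$, $h(x,y):=|\{z\in X: x\prec z\prec y\}|$. -}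

module Defs where

open import Data.Nat using (ℕ; suc)
open import Data.Fin using (Fin; toℕ)
open import Data.List using (List; length; filter)
open import Data.List.Base using ()
open import Data.Fin.Base using ()
open import Data.Fin.Properties using (_≟_)
open import Data.Product using (_×_; Σ)
open import Data.Sum using (_⊎_)
open import Function.Definitions using (Bijective)
open import Relation.Binary.PropositionalEquality using (_≡_)
open import Relation.Binary.Core using (Rel)
open import Relation.Binary.Definitions using (Decidable)
open import Relation.Binary.Structures using (IsStrictPartialOrder)
open import Relation.Nullary.Decidable using (_⊎-dec_; _×-dec_)
import Data.List.Base as L
import Data.Fin as F

-- A finite poset on the ground set X = Fin n, given by its strict order ≺,
-- which we require to be decidable (so cardinalities can be counted).
record FinPoset (n : ℕ) : Set₁ where
  field
    _≺_           : Rel (Fin n) _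
    isStrictPO    : IsStrictPartialOrder _≡_ _≺_
    _≺?_          : Decidable _≺_

  _≼_ : Rel (Fin n) _
  y ≼ x = y ≡ x ⊎ y ≺ x

  _≼?_ : Decidable _≼_
  y ≼? x = (y ≟ x) ⊎-dec (y ≺? x)

  ℓ : Fin n → ℕ
  ℓ x = length (filter (λ y → y ≼? x) (L.allFin n))

  b : Fin n → ℕ
  b x = length (filter (λ y → x ≼? y) (L.allFin n))

  h : Fin n → Fin n → ℕ
  h x y = length (filter (λ z → (x ≺? z) ×-dec (z ≺? y)) (L.allFin n))

  -- A linear extension: a bijection f : X → [n] (here [n] is Fin n, the
  -- position of value m ∈ [n] being toℕ (f x) + 1) with f x < f y whenever x ≺ y.
  record LinearExtension : Set where
    field
      f         : Fin n → Fin n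
      bijective : Bijective _≡_ _≡_ f
      monotone  : ∀ {x y} → x ≺ y → f x F.< f y

{-# OPTIONS --safe #-}
-- Necessity: in a linear extension f with f(u_i) = a_i, the elements below u_i, the
-- elements above u_i and the elements strictly between u_i and u_j receive distinct
-- positions in [1, a_i], [a_i, n] and (a_i, a_j) respectively.
--
-- Sufficiency: fill the positions 1, …, n greedily. Position a_i goes to u_i. Any
-- other position t + 1 goes to a minimal unplaced element that is not above the first
-- pending u_i and lies below every pending u_j that is tight, i.e. whose unplaced
-- predecessors (u_j included) exactly fill the positions t + 1, …, a_j. The bound on
-- b(u_i) (no tight u_j) or on h(u_i, u_j) (tight u_j) provides such an element, and
-- placing it keeps the backlog of every u_j within a_j − t, so that u_j is ready when
-- position a_j is reached; the bound on ℓ(u_j) is this invariant at t = 0.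
module Submission where

open import Defs
open import Level using (Level; 0ℓ)
open import Data.Nat using (ℕ; zero; suc; _+_; _∸_; _≤_; _<_; z≤n; s≤s; s≤s⁻¹; _<?_; _≤?_)
  renaming (_≟_ to _≟ℕ_)
open import Data.Nat.Properties hiding (_≟_)
open import Data.Fin using (Fin; toℕ)
import Data.Fin as F
import Data.Fin.Properties as Finₚ
open Finₚ using (_≟_)
open import Data.Product using (Σ; _×_; _,_; proj₁; proj₂; ∃; curry)
open import Data.Sum using (_⊎_; inj₁; inj₂)
open import Data.Empty using (⊥; ⊥-elim)
open import Data.List using (length; filter; tabulate)
import Data.List.Base as L
open import Function using (_∘_; id)
open import Function.Bundles using (_⇔_; mk⇔)
open import Function.Definitions using (Injective)
open import Relation.Nullary using (¬_; yes; no; contradiction)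
open import Relation.Nullary.Decidable using (_×-dec_; _→-dec_; ¬?)
open import Relation.Unary using (Pred; Decidable; _∈_; _∉_; _⊆_; _≐_; _∩_; _∪_; ∁; Satisfiable)
open import Relation.Unary.Properties using (∁?; _∩?_; _∪?_)
open import Relation.Binary.PropositionalEquality
open import Relation.Binary.Core using (Rel)
open import Relation.Binary.Structures using (IsStrictPartialOrder)
import Relation.Binary.Definitions as B
open B using (tri<; tri≈; tri>)
open import Induction.WellFounded using (WellFounded; Acc; acc; module Subrelation)
import Relation.Binary.Construct.On as On
open import Data.Nat.Induction using (<-wellFounded)

private variable
  c p q r : Level
  A : Set c
  m n : ℕ

count : {P : Pred (Fin n) p} → Decidable P → ℕ
count {n = zero}  P? = 0
count {n = suc n} P? with P? F.zero
... | yes _ = suc (count (P? ∘ F.suc))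
... | no  _ = count (P? ∘ F.suc)

length-filter-tabulate : {B : Pred A p} (B? : Decidable B) (f : Fin n → A) →
  length (filter B? (tabulate f)) ≡ count (B? ∘ f)
length-filter-tabulate {n = zero}  B? f = refl
length-filter-tabulate {n = suc n} B? f with B? (f F.zero)
... | yes _ = cong suc (length-filter-tabulate B? (f ∘ F.suc))
... | no  _ = length-filter-tabulate B? (f ∘ F.suc)

length-filter-allFin : {P : Pred (Fin n) p} (P? : Decidable P) → length (filter P? (L.allFin n)) ≡ count P?
length-filter-allFin P? = length-filter-tabulate P? id

count≤n : {P : Pred (Fin n) p} (P? : Decidable P) → count P? ≤ n
count≤n {n = zero}  P? = z≤n
count≤n {n = suc n} P? with P? F.zero
... | yes _ = s≤s (count≤n (P? ∘ F.suc))
... | no  _ = m≤n⇒m≤1+n (count≤n (P? ∘ F.suc))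

⊆⇒count≤ : {P : Pred (Fin n) p} {Q : Pred (Fin n) q} (P? : Decidable P) (Q? : Decidable Q) →
  P ⊆ Q → count P? ≤ count Q?
⊆⇒count≤ {n = zero}  P? Q? P⊆Q = z≤n
⊆⇒count≤ {n = suc n} P? Q? P⊆Q with P? F.zero | Q? F.zero
... | yes _  | yes _  = s≤s (⊆⇒count≤ (P? ∘ F.suc) (Q? ∘ F.suc) P⊆Q)
... | yes p₀ | no ¬q₀ = contradiction (P⊆Q p₀) ¬q₀
... | no  _  | yes _  = m≤n⇒m≤1+n (⊆⇒count≤ (P? ∘ F.suc) (Q? ∘ F.suc) P⊆Q)
... | no  _  | no  _  = ⊆⇒count≤ (P? ∘ F.suc) (Q? ∘ F.suc) P⊆Q

⊂⇒count< : {P : Pred (Fin n) p} {Q : Pred (Fin n) q} (P? : Decidable P) (Q? : Decidable Q) → P ⊆ Q →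
  ∀ {x} → x ∈ Q → x ∉ P → count P? < count Q?
⊂⇒count< {n = suc n} P? Q? P⊆Q {x} x∈Q x∉P with P? F.zero | Q? F.zero | x
... | yes p₀ | no ¬q₀ | _     = contradiction (P⊆Q p₀) ¬q₀
... | yes p₀ | yes _  | F.zero = contradiction p₀ x∉P
... | yes _  | yes _  | F.suc x = s≤s (⊂⇒count< (P? ∘ F.suc) (Q? ∘ F.suc) P⊆Q {x} x∈Q x∉P)
... | no  _  | yes _  | _     = s≤s (⊆⇒count≤ (P? ∘ F.suc) (Q? ∘ F.suc) P⊆Q)
... | no  _  | no ¬q₀ | F.zero = contradiction x∈Q ¬q₀
... | no  _  | no  _  | F.suc x = ⊂⇒count< (P? ∘ F.suc) (Q? ∘ F.suc) P⊆Q {x} x∈Q x∉P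

count-cong : {P : Pred (Fin n) p} {Q : Pred (Fin n) q} (P? : Decidable P) (Q? : Decidable Q) →
  P ≐ Q → count P? ≡ count Q?
count-cong P? Q? (P⊆Q , Q⊆P) = ≤-antisym (⊆⇒count≤ P? Q? P⊆Q) (⊆⇒count≤ Q? P? Q⊆P)

count-split : {P : Pred (Fin n) p} {Q : Pred (Fin n) q} (P? : Decidable P) (Q? : Decidable Q) →
  count P? ≡ count (P? ∩? Q?) + count (P? ∩? ∁? Q?)
count-split {n = zero}  P? Q? = refl
count-split {n = suc n} P? Q? with P? F.zero | Q? F.zero
... | yes _ | yes _ = cong suc (count-split (P? ∘ F.suc) (Q? ∘ F.suc))
... | yes _ | no  _ = trans (cong suc (count-split (P? ∘ F.suc) (Q? ∘ F.suc))) (sym (+-suc _ _))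
... | no  _ | yes _ = count-split (P? ∘ F.suc) (Q? ∘ F.suc)
... | no  _ | no  _ = count-split (P? ∘ F.suc) (Q? ∘ F.suc)

count-complement : {P : Pred (Fin n) p} (P? : Decidable P) → count P? + count (∁? P?) ≡ n
count-complement {n = zero}  P? = refl
count-complement {n = suc n} P? with P? F.zero
... | yes _ = cong suc (count-complement (P? ∘ F.suc))
... | no  _ = trans (+-suc _ _) (cong suc (count-complement (P? ∘ F.suc)))

count-∅ : {P : Pred (Fin n) p} (P? : Decidable P) → (∀ x → x ∉ P) → count P? ≡ 0
count-∅ {n = zero}  P? P≡∅ = refl
count-∅ {n = suc n} P? P≡∅ with P? F.zero
... | yes p₀ = contradiction p₀ (P≡∅ F.zero)
... | no  _  = count-∅ (P? ∘ F.suc) (P≡∅ ∘ F.suc)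

count>0⇒∃ : {P : Pred (Fin n) p} (P? : Decidable P) → 0 < count P? → Satisfiable P
count>0⇒∃ {n = suc n} P? count>0 with P? F.zero
... | yes p₀ = F.zero , p₀
... | no  _  with x , px ← count>0⇒∃ (P? ∘ F.suc) count>0 = F.suc x , px

count≡n⇒∀ : {P : Pred (Fin n) p} (P? : Decidable P) → count P? ≡ n → ∀ x → x ∈ P
count≡n⇒∀ {n = suc n} P? count≡n x with P? F.zero | x
... | yes p₀ | F.zero  = p₀
... | yes _  | F.suc x = count≡n⇒∀ (P? ∘ F.suc) (suc-injective count≡n) x
... | no  _  | _       = contradiction count≡n (<⇒≢ (s≤s (count≤n (P? ∘ F.suc))))

count-singleton : (x : Fin n) → count (x ≟_) ≡ 1
count-singleton {n = suc n} F.zero = cong suc (count-∅ {n = n} ((F.zero ≟_) ∘ F.suc) (λ _ ()))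
count-singleton {n = suc n} (F.suc x) =
  trans (count-cong _ (x ≟_) (Finₚ.suc-injective , cong F.suc)) (count-singleton x)

count-remove : {P : Pred (Fin n) p} (P? : Decidable P) → ∀ {x} → x ∈ P →
  count P? ≡ suc (count (P? ∩? ∁? (x ≟_)))
count-remove {P = P} P? {x} x∈P = begin
  count P?                                              ≡⟨ count-split P? (x ≟_) ⟩
  count (P? ∩? (x ≟_)) + count (P? ∩? ∁? (x ≟_))        ≡⟨ cong (_+ others) (count-cong (P? ∩? (x ≟_)) (x ≟_) at-x) ⟩
  count (x ≟_) + count (P? ∩? ∁? (x ≟_))                ≡⟨ cong (_+ others) (count-singleton x) ⟩
  suc (count (P? ∩? ∁? (x ≟_)))                         ∎
  where
  open ≡-Reasoning
  others : ℕ
  others = count (P? ∩? ∁? (x ≟_))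
  at-x : (P ∩ (x ≡_)) ≐ (x ≡_)
  at-x = proj₂ , λ { refl → x∈P , refl }

count<⇒∃∖ : {P : Pred (Fin n) p} {Q : Pred (Fin n) q} (P? : Decidable P) (Q? : Decidable Q) →
  count Q? < count P? → Satisfiable (P ∩ ∁ Q)
count<⇒∃∖ P? Q? count-Q<P = count>0⇒∃ (P? ∩? ∁? Q?) (n≢0⇒n>0 λ count≡0 → <⇒≱ count-Q<P (begin
  count P?                                          ≡⟨ count-split P? Q? ⟩
  count (P? ∩? Q?) + count (P? ∩? ∁? Q?)            ≡⟨ cong (count (P? ∩? Q?) +_) count≡0 ⟩
  count (P? ∩? Q?) + 0                              ≡⟨ +-identityʳ _ ⟩
  count (P? ∩? Q?)                                  ≤⟨ ⊆⇒count≤ (P? ∩? Q?) Q? proj₂ ⟩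
  count Q?                                          ∎))
  where open ≤-Reasoning

⊆∪⇒count≤ : {P : Pred (Fin n) p} {Q : Pred (Fin n) q} {R : Pred (Fin n) r}
  (P? : Decidable P) (Q? : Decidable Q) (R? : Decidable R) → P ⊆ Q ∪ R →
  count P? ≤ count Q? + count R?
⊆∪⇒count≤ {P = P} {Q = Q} {R = R} P? Q? R? P⊆Q∪R = begin
  count P?                                 ≡⟨ count-split P? Q? ⟩
  count (P? ∩? Q?) + count (P? ∩? ∁? Q?)   ≤⟨ +-mono-≤ (⊆⇒count≤ (P? ∩? Q?) Q? proj₂) (⊆⇒count≤ (P? ∩? ∁? Q?) R? outside-Q) ⟩
  count Q? + count R?                      ∎
  where
  open ≤-Reasoning
  outside-Q : P ∩ ∁ Q ⊆ R
  outside-Q (px , x∉Q) with P⊆Q∪R px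
  ... | inj₁ x∈Q = contradiction x∈Q x∉Q
  ... | inj₂ x∈R = x∈R

count-injective : {P : Pred (Fin n) p} {Q : Pred (Fin m) q} (P? : Decidable P) (Q? : Decidable Q)
  (f : Fin n → Fin m) → Injective _≡_ _≡_ f → (∀ {x} → x ∈ P → f x ∈ Q) → count P? ≤ count Q?
count-injective {n = zero}  P? Q? f f-inj P→Q = z≤n
count-injective {n = suc n} P? Q? f f-inj P→Q with P? F.zero
... | no  _  = count-injective (P? ∘ F.suc) Q? (f ∘ F.suc) (Finₚ.suc-injective ∘ f-inj) P→Q
... | yes p₀ = begin
  suc (count (P? ∘ F.suc))                ≤⟨ s≤s (count-injective (P? ∘ F.suc) (Q? ∩? ∁? (f F.zero ≟_)) (f ∘ F.suc)
                                                    (Finₚ.suc-injective ∘ f-inj) (λ px → P→Q px , λ eq → 0≢suc (f-inj eq))) ⟩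
  suc (count (Q? ∩? ∁? (f F.zero ≟_)))    ≡⟨ count-remove Q? (P→Q p₀) ⟨
  count Q?                                ∎
  where
  open ≤-Reasoning
  0≢suc : ∀ {x : Fin n} → F.zero ≢ F.suc x
  0≢suc ()

in-window? : (lo hi : ℕ) → Decidable {A = Fin n} (λ x → lo ≤ toℕ x × toℕ x < hi)
in-window? lo hi x = (lo ≤? toℕ x) ×-dec (toℕ x <? hi)

count-window : (lo hi : ℕ) → count (in-window? {n} lo hi) ≤ hi ∸ lo
count-window {n = zero}  lo       hi       = z≤n
count-window {n = suc n} lo       zero     = ≤-trans (≤-reflexive (count-∅ (in-window? lo 0) λ _ ())) z≤n
count-window {n = suc n} zero     (suc hi) = s≤s (≤-trans
  (⊆⇒count≤ (in-window? 0 (suc hi) ∘ F.suc) (in-window? {n} 0 hi) λ (_ , x<hi) → z≤n , s≤s⁻¹ x<hi)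
  (count-window {n} 0 hi))
count-window {n = suc n} (suc lo) (suc hi) = ≤-trans
  (⊆⇒count≤ (in-window? (suc lo) (suc hi) ∘ F.suc) (in-window? {n} lo hi) λ (lo≤x , x<hi) → s≤s⁻¹ lo≤x , s≤s⁻¹ x<hi)
  (count-window {n} lo hi)

∃-minimal : {C : Pred (Fin m) p} {_⊏_ : Rel (Fin m) r} → Decidable C → B.Decidable _⊏_ →
  (μ : Fin m → ℕ) → (∀ {x y} → x ⊏ y → μ x < μ y) →
  Satisfiable C → ∃ λ x → x ∈ C × (∀ {y} → y ⊏ x → y ∉ C)
∃-minimal {C = C} {_⊏_} C? _⊏?_ μ μ-mono (x , x∈C) = descend x x∈C (⊏-wellFounded x)
  where
  ⊏-wellFounded : WellFounded _⊏_
  ⊏-wellFounded = Subrelation.wellFounded μ-mono (On.wellFounded μ <-wellFounded)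

  descend : ∀ x → x ∈ C → Acc _⊏_ x → ∃ λ x → x ∈ C × (∀ {y} → y ⊏ x → y ∉ C)
  descend x x∈C (acc rs) with Finₚ.any? (λ y → (y ⊏? x) ×-dec C? y)
  ... | yes (y , y⊏x , y∈C) = descend y y∈C (rs y⊏x)
  ... | no  ∄y              = x , x∈C , λ y⊏x y∈C → ∄y (_ , y⊏x , y∈C)

∃-first : {Q : Pred (Fin m) p} → Decidable Q → Satisfiable Q → ∃ λ i → i ∈ Q × (∀ {j} → j ∈ Q → i F.≤ j)
∃-first Q? Q-nonempty with i , i∈Q , i-minimal ← ∃-minimal Q? F._<?_ toℕ id Q-nonempty =
  i , i∈Q , λ j∈Q → ≮⇒≥ (λ j<i → i-minimal j<i j∈Q)

m∸n+1<m∸o : ∀ {m n o} → 2 + o ≤ n → n ≤ m → m ∸ n + 1 < m ∸ o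
m∸n+1<m∸o {m} {suc n} {o} (s≤s o<n) 1+n≤m = begin-strict
  m ∸ suc n + 1    ≡⟨ +-comm _ 1 ⟩
  suc (m ∸ suc n)  ≡⟨ +-∸-assoc 1 1+n≤m ⟨
  m ∸ n            <⟨ ∸-monoʳ-< o<n (≤-trans (n≤1+n n) 1+n≤m) ⟩
  m ∸ o            ∎
  where open ≤-Reasoning

module FinPosetProperties {n : ℕ} (P : FinPoset n) where
  open FinPoset P
  open IsStrictPartialOrder isStrictPO using (irrefl) renaming (trans to ≺-trans)

  ≺-irrefl : ∀ {x} → ¬ x ≺ x
  ≺-irrefl = irrefl refl

  ≼-≺-trans : ∀ {x y z} → x ≼ y → y ≺ z → x ≺ z
  ≼-≺-trans (inj₁ refl) y≺z = y≺z
  ≼-≺-trans (inj₂ x≺y)  y≺z = ≺-trans x≺y y≺z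

  ≺-≼-trans : ∀ {x y z} → x ≺ y → y ≼ z → x ≺ z
  ≺-≼-trans x≺y (inj₁ refl) = x≺y
  ≺-≼-trans x≺y (inj₂ y≺z)  = ≺-trans x≺y y≺z

  ≼-trans : ∀ {x y z} → x ≼ y → y ≼ z → x ≼ z
  ≼-trans (inj₁ refl) y≼z = y≼z
  ≼-trans (inj₂ x≺y)  y≼z = inj₂ (≺-≼-trans x≺y y≼z)

  ≼-antisym : ∀ {x y} → x ≼ y → y ≼ x → x ≡ y
  ≼-antisym (inj₁ x≡y) _           = x≡y
  ≼-antisym (inj₂ _)   (inj₁ y≡x)  = sym y≡x
  ≼-antisym (inj₂ x≺y) (inj₂ y≺x)  = contradiction (≺-trans x≺y y≺x) ≺-irrefl

  between? : (x y : Fin n) → Decidable (λ z → x ≼ z × z ≼ y)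
  between? x y z = (x ≼? z) ×-dec (z ≼? y)

  count-between-≤ : ∀ x y → count (between? x y) ≤ 2 + h x y
  count-between-≤ x y = begin
    count (between? x y)
      ≤⟨ ⊆∪⇒count≤ (between? x y) (x ≟_) ((y ≟_) ∪? strictly) endpoint-or-inner ⟩
    count (x ≟_) + count ((y ≟_) ∪? strictly)
      ≤⟨ +-mono-≤ (≤-reflexive (count-singleton x)) (⊆∪⇒count≤ _ (y ≟_) strictly id) ⟩
    1 + (count (y ≟_) + count strictly)
      ≡⟨ cong₂ (λ c d → 1 + (c + d)) (count-singleton y) (sym (length-filter-allFin strictly)) ⟩
    2 + h x y
      ∎
    where
    open ≤-Reasoning
    strictly : Decidable (λ z → x ≺ z × z ≺ y)
    strictly z = (x ≺? z) ×-dec (z ≺? y)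
    endpoint-or-inner : ∀ {z} → x ≼ z × z ≼ y → x ≡ z ⊎ (y ≡ z ⊎ (x ≺ z × z ≺ y))
    endpoint-or-inner (inj₁ x≡z , _)          = inj₁ x≡z
    endpoint-or-inner (inj₂ _   , inj₁ z≡y)   = inj₂ (inj₁ (sym z≡y))
    endpoint-or-inner (inj₂ x≺z , inj₂ z≺y)   = inj₂ (inj₂ (x≺z , z≺y))

  count-between-refl : ∀ x → count (between? x x) ≤ 1
  count-between-refl x = begin
    count (between? x x)  ≤⟨ ⊆⇒count≤ (between? x x) (x ≟_) (λ (x≼z , z≼x) → ≼-antisym x≼z z≼x) ⟩
    count (x ≟_)          ≡⟨ count-singleton x ⟩
    1                     ∎
    where open ≤-Reasoning

  ∃-≺-minimal : {C : Pred (Fin n) p} → Decidable C → Satisfiable C →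
    ∃ λ x → x ∈ C × (∀ {y} → y ≺ x → y ∉ C)
  ∃-≺-minimal C? = ∃-minimal C? _≺?_ (λ x → count (_≺? x))
    (λ {y} y≺x → ⊂⇒count< (_≺? y) (_≺? _) (λ z≺y → ≺-trans z≺y y≺x) y≺x ≺-irrefl)

  count-≤-window : (L : LinearExtension) {Q : Pred (Fin n) q} (Q? : Decidable Q) (lo hi : ℕ) →
    (∀ {x} → x ∈ Q → lo ≤ toℕ (LinearExtension.f L x) × toℕ (LinearExtension.f L x) < hi) →
    count Q? ≤ hi ∸ lo
  count-≤-window L Q? lo hi in-window = ≤-trans
    (count-injective Q? (in-window? {n} lo hi) f (proj₁ bijective) in-window)
    (count-window {n} lo hi)
    where open LinearExtension L

  -- The first t positions are filled: an element is placed iff its rank is below t,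
  -- and every unplaced element carries the junk rank n.
  record PartialExtension (t : ℕ) : Set where
    field
      rank            : Fin n → ℕ
      unplaced-rank   : ∀ {x} → ¬ rank x < t → rank x ≡ n
      count-placed    : count (λ x → rank x <? t) ≡ t
      rank-monotone   : ∀ {x y} → x ≺ y → rank y < t → rank x < rank y
      rank-injective  : ∀ {x y} → rank x < t → rank x ≡ rank y → x ≡ y
      rank-surjective : ∀ {s} → s < t → ∃ λ x → rank x ≡ s

    Placed : Pred (Fin n) 0ℓ
    Placed x = rank x < t

    placed? : Decidable Placed
    placed? x = rank x <? t

    rank≢t : t < n → ∀ {x} → rank x ≢ t
    rank≢t t<n {x} rank≡t with rank x <? t
    ... | yes rank<t = <-irrefl rank≡t rank<t
    ... | no  rank≮t = <-irrefl (trans (sym rank≡t) (unplaced-rank rank≮t)) t<n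

    rank≤t⇒placed : t < n → ∀ {x} → rank x ≤ t → x ∈ Placed
    rank≤t⇒placed t<n rank≤t = ≤∧≢⇒< rank≤t (rank≢t t<n)

  module Extension {t} (S : PartialExtension t) (t<n : t < n) (x : Fin n)
                   (x-unplaced : x ∉ PartialExtension.Placed S)
                   (x-ready : ∀ {y} → y ≺ x → y ∈ PartialExtension.Placed S) where
    open PartialExtension S

    rank′ : Fin n → ℕ
    rank′ y with x ≟ y
    ... | yes _ = t
    ... | no  _ = rank y

    rank′-new : rank′ x ≡ t
    rank′-new with x ≟ x
    ... | yes _   = refl
    ... | no  x≢x = contradiction refl x≢x

    rank′-old : ∀ {y} → x ≢ y → rank′ y ≡ rank y
    rank′-old {y} x≢y with x ≟ y
    ... | yes x≡y = contradiction x≡y x≢y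
    ... | no  _   = refl

    placed⇒≢x : ∀ {y} → y ∈ Placed → x ≢ y
    placed⇒≢x y∈P refl = x-unplaced y∈P

    rank′-placed : ∀ {y} → y ∈ Placed → rank′ y ≡ rank y
    rank′-placed y∈P = rank′-old (placed⇒≢x y∈P)

    x-placed : rank′ x < suc t
    x-placed = subst (_< suc t) (sym rank′-new) ≤-refl

    placed-stays : ∀ {y} → y ∈ Placed → rank′ y < suc t
    placed-stays y∈P = subst (_< suc t) (sym (rank′-placed y∈P)) (m<n⇒m<1+n y∈P)

    extension : PartialExtension (suc t)
    extension = record
      { rank            = rank′
      ; unplaced-rank   = unplaced-rank′
      ; count-placed    = count-placed′
      ; rank-monotone   = rank-monotone′
      ; rank-injective  = rank-injective′
      ; rank-surjective = rank-surjective′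
      }
      where
      placed′⇒placed : ∀ {y} → x ≢ y → rank′ y < suc t → y ∈ Placed
      placed′⇒placed x≢y rank′<1+t =
        rank≤t⇒placed t<n (s≤s⁻¹ (subst (_< suc t) (rank′-old x≢y) rank′<1+t))

      unplaced-rank′ : ∀ {y} → ¬ rank′ y < suc t → rank′ y ≡ n
      unplaced-rank′ {y} rank′≮1+t with x ≟ y
      ... | yes _ = contradiction ≤-refl rank′≮1+t
      ... | no  _ = unplaced-rank (rank′≮1+t ∘ m<n⇒m<1+n)

      count-placed′ : count (λ y → rank′ y <? suc t) ≡ suc t
      count-placed′ = begin
        count (λ y → rank′ y <? suc t)
          ≡⟨ count-remove (λ y → rank′ y <? suc t) x-placed ⟩
        suc (count ((λ y → rank′ y <? suc t) ∩? ∁? (x ≟_)))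
          ≡⟨ cong suc (count-cong _ placed? (old-placed , λ y∈P → placed-stays y∈P , placed⇒≢x y∈P)) ⟩
        suc (count placed?)
          ≡⟨ cong suc count-placed ⟩
        suc t
          ∎
        where
        open ≡-Reasoning
        old-placed : ∀ {y} → rank′ y < suc t × x ≢ y → y ∈ Placed
        old-placed (rank′<1+t , x≢y) = placed′⇒placed x≢y rank′<1+t

      rank-monotone′ : ∀ {y z} → y ≺ z → rank′ z < suc t → rank′ y < rank′ z
      rank-monotone′ {y} {z} y≺z rank′z<1+t with x ≟ z
      ... | yes refl = subst (_< t) (sym (rank′-placed (x-ready y≺z))) (x-ready y≺z)
      ... | no  x≢z  = subst (_< rank z) (sym (rank′-placed y∈P)) rank-y<rank-z
        where
        z∈P : z ∈ Placed
        z∈P = placed′⇒placed x≢z (subst (_< suc t) (sym (rank′-old x≢z)) rank′z<1+t)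
        rank-y<rank-z : rank y < rank z
        rank-y<rank-z = rank-monotone y≺z z∈P
        y∈P : y ∈ Placed
        y∈P = <-trans rank-y<rank-z z∈P

      rank-injective′ : ∀ {y z} → rank′ y < suc t → rank′ y ≡ rank′ z → y ≡ z
      rank-injective′ {y} {z} rank′y<1+t eq with x ≟ y | x ≟ z
      ... | yes x≡y | yes x≡z = trans (sym x≡y) x≡z
      ... | yes _   | no  _   = contradiction (sym eq) (rank≢t t<n)
      ... | no  _   | yes _   = contradiction eq (rank≢t t<n)
      ... | no  _   | no  _   = rank-injective (rank≤t⇒placed t<n (s≤s⁻¹ rank′y<1+t)) eq

      rank-surjective′ : ∀ {s} → s < suc t → ∃ λ y → rank′ y ≡ s
      rank-surjective′ {s} s<1+t with m≤n⇒m<n∨m≡n (s≤s⁻¹ s<1+t)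
      ... | inj₂ refl = x , rank′-new
      ... | inj₁ s<t  with y , rank≡s ← rank-surjective s<t =
        y , trans (rank′-placed (subst (_< t) (sym rank≡s) s<t)) rank≡s

    open PartialExtension extension using () renaming (Placed to Placed′)

    unplaced-extension : ∁ Placed′ ≐ ∁ Placed ∩ ∁ (x ≡_)
    unplaced-extension = still-unplaced , now-unplaced
      where
      still-unplaced : ∀ {y} → y ∉ Placed′ → y ∉ Placed × x ≢ y
      still-unplaced y∉P′ = y∉P′ ∘ placed-stays , λ { refl → y∉P′ x-placed }
      now-unplaced : ∀ {y} → y ∉ Placed × x ≢ y → y ∉ Placed′
      now-unplaced (y∉P , x≢y) rank′<1+t =
        <-irrefl (unplaced-rank y∉P) (<-≤-trans (subst (_< suc t) (rank′-old x≢y) rank′<1+t) t<n)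

  empty : PartialExtension 0
  empty = record
    { rank            = λ _ → n
    ; unplaced-rank   = λ _ → refl
    ; count-placed    = count-∅ {n = n} (λ _ → n <? 0) (λ _ ())
    ; rank-monotone   = λ _ ()
    ; rank-injective  = λ ()
    ; rank-surjective = λ ()
    }

  module Completion (S : PartialExtension n) where
    open PartialExtension S

    all-placed : ∀ x → x ∈ Placed
    all-placed = count≡n⇒∀ placed? count-placed

    position : Fin n → Fin n
    position x = F.fromℕ< (all-placed x)

    toℕ-position : ∀ x → toℕ (position x) ≡ rank x
    toℕ-position x = Finₚ.toℕ-fromℕ< (all-placed x)

    position-injective : ∀ {x y} → position x ≡ position y → x ≡ y
    position-injective {x} {y} eq = rank-injective (all-placed x)
      (trans (sym (toℕ-position x)) (trans (cong toℕ eq) (toℕ-position y)))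

    position-surjective : ∀ s → ∃ λ x → ∀ {y} → y ≡ x → position y ≡ s
    position-surjective s with x , rank≡s ← rank-surjective (Finₚ.toℕ<n s) =
      x , λ { refl → Finₚ.toℕ-injective (trans (toℕ-position x) rank≡s) }

    position-monotone : ∀ {x y} → x ≺ y → position x F.< position y
    position-monotone {x} {y} x≺y =
      subst₂ _<_ (sym (toℕ-position x)) (sym (toℕ-position y)) (rank-monotone x≺y (all-placed y))

    linearExtension : LinearExtension
    linearExtension = record
      { f         = position
      ; bijective = position-injective , position-surjective
      ; monotone  = position-monotone
      }

module Prescription {n k : ℕ} (P : FinPoset n) (u : Fin k → Fin n) (a : Fin k → ℕ) where
  open FinPoset P
  open FinPosetProperties P

  Respects : LinearExtension → Set
  Respects L = ∀ i → suc (toℕ (LinearExtension.f L (u i))) ≡ a i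

  Feasible : Set
  Feasible = (∀ i → ℓ (u i) ≤ a i × b (u i) ≤ n ∸ a i + 1)
           × (∀ i j → i F.< j → h (u i) (u j) < a j ∸ a i)

  respects⇒feasible : (∀ {i j} → i F.< j → u i ≺ u j) →
    (L : LinearExtension) → Respects L → Feasible
  respects⇒feasible u-chain L respects = (λ i → ℓ-bound i , b-bound i) , h-bound
    where
    open LinearExtension L
    open ≤-Reasoning

    pos : Fin n → ℕ
    pos x = toℕ (f x)

    pos-≼ : ∀ {x y} → x ≼ y → pos x ≤ pos y
    pos-≼ (inj₁ refl) = ≤-refl
    pos-≼ (inj₂ x≺y)  = <⇒≤ (monotone x≺y)

    ℓ-bound : ∀ i → ℓ (u i) ≤ a i
    ℓ-bound i = begin
      ℓ (u i)               ≡⟨ length-filter-allFin (_≼? u i) ⟩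
      count (_≼? u i)       ≤⟨ count-≤-window L _ 0 (suc (pos (u i))) (λ y≼u → z≤n , s≤s (pos-≼ y≼u)) ⟩
      suc (pos (u i))       ≡⟨ respects i ⟩
      a i                   ∎

    b-bound : ∀ i → b (u i) ≤ n ∸ a i + 1
    b-bound i = begin
      b (u i)                   ≡⟨ length-filter-allFin (u i ≼?_) ⟩
      count (u i ≼?_)           ≤⟨ count-≤-window L _ (pos (u i)) n (λ u≼y → pos-≼ u≼y , Finₚ.toℕ<n _) ⟩
      n ∸ pos (u i)             ≡⟨ +-∸-assoc 1 (Finₚ.toℕ<n (f (u i))) ⟩
      1 + (n ∸ suc (pos (u i))) ≡⟨ +-comm 1 _ ⟩
      n ∸ suc (pos (u i)) + 1   ≡⟨ cong (λ c → n ∸ c + 1) (respects i) ⟩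
      n ∸ a i + 1               ∎

    h-bound : ∀ i j → i F.< j → h (u i) (u j) < a j ∸ a i
    h-bound i j i<j = begin-strict
      h (u i) (u j)                      ≡⟨ length-filter-allFin strictly-between ⟩
      count strictly-between             ≤⟨ count-≤-window L strictly-between (suc (pos (u i))) (pos (u j))
                                              (λ (ui≺z , z≺uj) → monotone ui≺z , monotone z≺uj) ⟩
      pos (u j) ∸ suc (pos (u i))        <⟨ ∸-monoʳ-< (n<1+n _) (monotone (u-chain i<j)) ⟩
      suc (pos (u j)) ∸ suc (pos (u i))  ≡⟨ cong₂ _∸_ (respects j) (respects i) ⟩
      a j ∸ a i                          ∎
      where
      strictly-between : Decidable (λ z → u i ≺ z × z ≺ u j)
      strictly-between z = (u i ≺? z) ×-dec (z ≺? u j)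

  module Construction
    (u-chain : ∀ {i j} → i F.< j → u i ≺ u j)
    (a-positive : ∀ i → 1 ≤ a i) (a≤n : ∀ i → a i ≤ n)
    (a-mono : ∀ {i j} → i F.< j → a i < a j)
    (feasible : Feasible) where

    ℓ-bound : ∀ i → ℓ (u i) ≤ a i
    ℓ-bound i = proj₁ (proj₁ feasible i)

    b-bound : ∀ i → b (u i) ≤ n ∸ a i + 1
    b-bound i = proj₂ (proj₁ feasible i)

    h-bound : ∀ i j → i F.< j → h (u i) (u j) < a j ∸ a i
    h-bound = proj₂ feasible

    u-mono-≼ : ∀ {i j} → i F.≤ j → u i ≼ u j
    u-mono-≼ i≤j with m≤n⇒m<n∨m≡n i≤j
    ... | inj₁ i<j = inj₂ (u-chain i<j)
    ... | inj₂ i≡j = inj₁ (cong u (Finₚ.toℕ-injective i≡j))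

    a-mono-≤ : ∀ {i j} → i F.≤ j → a i ≤ a j
    a-mono-≤ i≤j with m≤n⇒m<n∨m≡n i≤j
    ... | inj₁ i<j = <⇒≤ (a-mono i<j)
    ... | inj₂ i≡j = ≤-reflexive (cong a (Finₚ.toℕ-injective i≡j))

    u-injective : ∀ {i j} → u i ≡ u j → i ≡ j
    u-injective {i} {j} ui≡uj with Finₚ.<-cmp i j
    ... | tri< i<j _ _ = contradiction (subst (u i ≺_) (sym ui≡uj) (u-chain i<j)) ≺-irrefl
    ... | tri≈ _ i≡j _ = i≡j
    ... | tri> _ _ j<i = contradiction (subst (_≺ u i) (sym ui≡uj) (u-chain j<i)) ≺-irrefl

    a-injective : ∀ {i j} → a i ≡ a j → i ≡ j
    a-injective {i} {j} ai≡aj with Finₚ.<-cmp i j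
    ... | tri< i<j _ _ = contradiction ai≡aj (<⇒≢ (a-mono i<j))
    ... | tri≈ _ i≡j _ = i≡j
    ... | tri> _ _ j<i = contradiction (sym ai≡aj) (<⇒≢ (a-mono j<i))

    a-reflects-< : ∀ {i j} → a i < a j → i F.< j
    a-reflects-< {i} {j} ai<aj with Finₚ.<-cmp i j
    ... | tri< i<j _ _  = i<j
    ... | tri≈ _ refl _ = contradiction ai<aj (<-irrefl refl)
    ... | tri> _ _ j<i  = contradiction (a-mono j<i) (<-asym ai<aj)

    count-between-chain : ∀ {i j} → i F.≤ j → count (between? (u i) (u j)) ≤ a j ∸ a i + 1
    count-between-chain {i} {j} i≤j with m≤n⇒m<n∨m≡n i≤j
    ... | inj₂ i≡j rewrite Finₚ.toℕ-injective i≡j =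
      subst (count (between? (u j) (u j)) ≤_) (cong (_+ 1) (sym (n∸n≡0 (a j)))) (count-between-refl (u j))
    ... | inj₁ i<j = begin
      count (between? (u i) (u j))  ≤⟨ count-between-≤ (u i) (u j) ⟩
      2 + h (u i) (u j)             ≤⟨ s≤s (h-bound i j i<j) ⟩
      1 + (a j ∸ a i)               ≡⟨ +-comm 1 _ ⟩
      a j ∸ a i + 1                 ∎
      where open ≤-Reasoning

    module _ {t} (S : PartialExtension t) where
      open PartialExtension S

      unplaced-below? : (i : Fin k) → Decidable (∁ Placed ∩ (_≼ u i))
      unplaced-below? i = ∁? placed? ∩? (_≼? u i)

      backlog : Fin k → ℕ
      backlog i = count (unplaced-below? i)

      Tight : Pred (Fin k) 0ℓ
      Tight i = t < a i × backlog i ≡ a i ∸ t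

      tight? : Decidable Tight
      tight? i = (t <? a i) ×-dec (backlog i ≟ℕ a i ∸ t)

      -- The unplaced elements below a pending u i all need positions in t, …, a i − 1.
      record OnSchedule : Set where
        field
          chain-placed  : ∀ i → a i ≤ t → suc (rank (u i)) ≡ a i
          chain-pending : ∀ i → t < a i → u i ∉ Placed
          backlog-bound : ∀ i → t < a i → backlog i ≤ a i ∸ t

      record Eligible (x : Fin n) : Set where
        field
          unplaced    : x ∉ Placed
          ready       : ∀ {y} → y ≺ x → y ∈ Placed
          on-time     : ∀ i → t < a i → u i ≡ x → a i ≡ suc t
          due         : ∀ i → a i ≡ suc t → u i ≡ x
          below-tight : ∀ i → suc t < a i → Tight i → x ≼ u i

    empty-on-schedule : OnSchedule empty
    empty-on-schedule = record
      { chain-placed  = λ i a≤0 → contradiction (≤-trans (a-positive i) a≤0) λ ()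
      ; chain-pending = λ _ _ ()
      ; backlog-bound = λ i _ → begin
          backlog empty i  ≤⟨ ⊆⇒count≤ _ (_≼? u i) proj₂ ⟩
          count (_≼? u i)  ≡⟨ length-filter-allFin (_≼? u i) ⟨
          ℓ (u i)          ≤⟨ ℓ-bound i ⟩
          a i              ∎
      }
      where open ≤-Reasoning

    module Step {t} (S : PartialExtension t) (t<n : t < n) (sched : OnSchedule S) where
      open PartialExtension S
      open OnSchedule sched

      count-unplaced : count (∁? placed?) ≡ n ∸ t
      count-unplaced = begin
        count (∁? placed?)                        ≡⟨ m+n∸m≡n t _ ⟨
        t + count (∁? placed?) ∸ t                ≡⟨ cong (λ c → c + count (∁? placed?) ∸ t) count-placed ⟨
        count placed? + count (∁? placed?) ∸ t    ≡⟨ cong (_∸ t) (count-complement placed?) ⟩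
        n ∸ t                                     ∎
        where open ≡-Reasoning

      due-eligible : ∀ j → a j ≡ suc t → Eligible S (u j)
      due-eligible j aj≡1+t = record
        { unplaced    = uj-unplaced
        ; ready       = ready
        ; on-time     = λ i _ ui≡uj → trans (cong a (u-injective ui≡uj)) aj≡1+t
        ; due         = λ i ai≡1+t → cong u (a-injective (trans ai≡1+t (sym aj≡1+t)))
        ; below-tight = λ i 1+t<ai _ → inj₂ (u-chain (a-reflects-< (subst (_< a i) (sym aj≡1+t) 1+t<ai)))
        }
        where
        t<aj : t < a j
        t<aj = subst (t <_) (sym aj≡1+t) (n<1+n t)

        uj-unplaced : u j ∉ Placed
        uj-unplaced = chain-pending j t<aj

        -- A second unplaced element below u j would push the backlog of u j beyond a j − t = 1.
        ready : ∀ {y} → y ≺ u j → y ∈ Placed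
        ready {y} y≺uj with placed? y
        ... | yes y∈P = y∈P
        ... | no  y∉P = contradiction (subst (backlog S j ≤_) budget (backlog-bound j t<aj)) (<⇒≱ (begin-strict
          1                   ≡⟨ count-singleton (u j) ⟨
          count (u j ≟_)      <⟨ ⊂⇒count< (u j ≟_) (unplaced-below? S j) (λ { refl → uj-unplaced , inj₁ refl })
                                   (y∉P , inj₂ y≺uj) (λ { refl → ≺-irrefl y≺uj }) ⟩
          backlog S j         ∎))
          where
          open ≤-Reasoning
          budget : a j ∸ t ≡ 1
          budget = trans (cong (_∸ t) aj≡1+t) (m+n∸n≡m 1 t)

      module Candidates (nothing-due : ∀ j → a j ≢ suc t) where

        Candidate : Pred (Fin n) 0ℓ
        Candidate y = y ∉ Placed × (∀ i → t < a i → ¬ u i ≼ y) × (∀ i → Tight S i → y ≼ u i)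

        candidate? : Decidable Candidate
        candidate? y = ∁? placed? y
                 ×-dec Finₚ.all? (λ i → (t <? a i) →-dec ¬? (u i ≼? y))
                 ×-dec Finₚ.all? (λ i → tight? S i →-dec (y ≼? u i))

        minimal-candidate-eligible : ∀ {x} → x ∈ Candidate → (∀ {y} → y ≺ x → y ∉ Candidate) → Eligible S x
        minimal-candidate-eligible {x} (x∉P , x-beyond , x-below) x-minimal = record
          { unplaced    = x∉P
          ; ready       = ready
          ; on-time     = λ i pending ui≡x → contradiction (inj₁ ui≡x) (x-beyond i pending)
          ; due         = λ i ai≡1+t → contradiction ai≡1+t (nothing-due i)
          ; below-tight = λ i _ tight → x-below i tight
          }
          where
          ready : ∀ {y} → y ≺ x → y ∈ Placed
          ready {y} y≺x with placed? y
          ... | yes y∈P = y∈P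
          ... | no  y∉P = contradiction
            (y∉P , (λ i pending ui≼y → x-beyond i pending (inj₂ (≼-≺-trans ui≼y y≺x)))
                 , (λ i tight → ≼-trans (inj₂ y≺x) (x-below i tight)))
            (x-minimal y≺x)

        module FirstPending {i₀} (i₀-pending : t < a i₀) (i₀-first : ∀ {i} → t < a i → i₀ F.≤ i) where
          open ≤-Reasoning

          2+t≤a₀ : 2 + t ≤ a i₀
          2+t≤a₀ = ≤∧≢⇒< i₀-pending (λ 1+t≡a₀ → nothing-due i₀ (sym 1+t≡a₀))

          beyond-first : ∀ {y} → y ∉ Placed → ¬ u i₀ ≼ y → (∀ i → Tight S i → y ≼ u i) → y ∈ Candidate
          beyond-first y∉P u₀⋠y y-below =
            y∉P , (λ i pending ui≼y → u₀⋠y (≼-trans (u-mono-≼ (i₀-first pending)) ui≼y)) , y-below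

          candidate-if-none-tight : (∀ i → Tight S i → ⊥) → Satisfiable Candidate
          candidate-if-none-tight none-tight =
            let y , y∉P , u₀⋠y = count<⇒∃∖ (∁? placed?) (u i₀ ≼?_) (begin-strict
                  count (u i₀ ≼?_)    ≡⟨ length-filter-allFin (u i₀ ≼?_) ⟨
                  b (u i₀)            ≤⟨ b-bound i₀ ⟩
                  n ∸ a i₀ + 1        <⟨ m∸n+1<m∸o 2+t≤a₀ (a≤n i₀) ⟩
                  n ∸ t               ≡⟨ count-unplaced ⟨
                  count (∁? placed?)  ∎)
            in y , beyond-first y∉P u₀⋠y (λ i tight → ⊥-elim (none-tight i tight))

          candidate-below-first-tight : ∀ {i₁} → Tight S i₁ → (∀ {i} → Tight S i → i₁ F.≤ i) →
            Satisfiable Candidate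
          candidate-below-first-tight {i₁} i₁-tight i₁-first =
            let y , (y∉P , y≼u₁) , y-outside = count<⇒∃∖ (unplaced-below? S i₁) (between? (u i₀) (u i₁)) (begin-strict
                  count (between? (u i₀) (u i₁))  ≤⟨ count-between-chain i₀≤i₁ ⟩
                  a i₁ ∸ a i₀ + 1                 <⟨ m∸n+1<m∸o 2+t≤a₀ (a-mono-≤ i₀≤i₁) ⟩
                  a i₁ ∸ t                        ≡⟨ proj₂ i₁-tight ⟨
                  backlog S i₁                    ∎)
            in y , beyond-first y∉P (λ u₀≼y → y-outside (u₀≼y , y≼u₁))
                                    (λ i tight → ≼-trans y≼u₁ (u-mono-≼ (i₁-first tight)))
            where
            i₀≤i₁ : i₀ F.≤ i₁
            i₀≤i₁ = i₀-first (proj₁ i₁-tight)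

        candidate-exists : Satisfiable Candidate
        candidate-exists with Finₚ.any? (λ i → t <? a i)
        ... | no none-pending =
          let y , y∉P = count>0⇒∃ (∁? placed?) (subst (0 <_) (sym count-unplaced) (m<n⇒0<n∸m t<n))
          in y , y∉P , (λ i pending → contradiction (i , pending) none-pending)
                     , (λ i tight → contradiction (i , proj₁ tight) none-pending)
        ... | yes some-pending with i₀ , i₀-pending , i₀-first ← ∃-first (λ i → t <? a i) some-pending
                             with Finₚ.any? (tight? S)
        ...   | no none-tight =
          FirstPending.candidate-if-none-tight i₀-pending i₀-first (λ i tight → none-tight (i , tight))
        ...   | yes some-tight with i₁ , i₁-tight , i₁-first ← ∃-first (tight? S) some-tight =
          FirstPending.candidate-below-first-tight i₀-pending i₀-first i₁-tight i₁-first

      open Candidates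

      eligible-exists : ∃ (Eligible S)
      eligible-exists with Finₚ.any? (λ j → a j ≟ℕ suc t)
      ... | yes (j , aj≡1+t) = u j , due-eligible j aj≡1+t
      ... | no  none-due
        with x , x∈C , x-minimal ← ∃-≺-minimal (candidate? (curry none-due)) (candidate-exists (curry none-due)) =
        x , minimal-candidate-eligible (curry none-due) x∈C x-minimal

      extend-on-schedule : ∀ {x} (e : Eligible S x) →
        OnSchedule (Extension.extension S t<n x (Eligible.unplaced e) (Eligible.ready e))
      extend-on-schedule {x} e = record
        { chain-placed  = chain-placed′
        ; chain-pending = chain-pending′
        ; backlog-bound = backlog-bound′
        }
        where
        open Eligible e
        open Extension S t<n x unplaced ready

        backlog-drop : ∀ i → backlog extension i ≡ count (unplaced-below? S i ∩? ∁? (x ≟_))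
        backlog-drop i = count-cong (unplaced-below? extension i) (unplaced-below? S i ∩? ∁? (x ≟_))
          ( (λ (y∉P′ , y≼ui) → let y∉P , x≢y = proj₁ unplaced-extension y∉P′ in (y∉P , y≼ui) , x≢y)
          , (λ ((y∉P , y≼ui) , x≢y) → proj₂ unplaced-extension (y∉P , x≢y) , y≼ui) )

        chain-placed′ : ∀ i → a i ≤ suc t → suc (rank′ (u i)) ≡ a i
        chain-placed′ i ai≤1+t with m≤n⇒m<n∨m≡n ai≤1+t
        ... | inj₂ ai≡1+t = trans (cong (suc ∘ rank′) (due i ai≡1+t)) (trans (cong suc rank′-new) (sym ai≡1+t))
        ... | inj₁ ai<1+t = trans (cong suc (rank′-placed ui∈P)) (chain-placed i ai≤t)
          where
          ai≤t : a i ≤ t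
          ai≤t = s≤s⁻¹ ai<1+t
          ui∈P : u i ∈ Placed
          ui∈P = subst (_≤ t) (sym (chain-placed i ai≤t)) ai≤t

        chain-pending′ : ∀ i → suc t < a i → u i ∉ PartialExtension.Placed extension
        chain-pending′ i 1+t<ai = proj₂ unplaced-extension
          (chain-pending i t<ai , λ x≡ui → <-irrefl (sym (on-time i t<ai (sym x≡ui))) 1+t<ai)
          where
          t<ai : t < a i
          t<ai = <-trans (n<1+n t) 1+t<ai

        backlog-bound′ : ∀ i → suc t < a i → backlog extension i ≤ a i ∸ suc t
        backlog-bound′ i 1+t<ai with tight? S i
        ... | yes tight = ≤-reflexive (suc-injective (begin
              suc (backlog extension i)  ≡⟨ cong suc (backlog-drop i) ⟩
              suc (count (unplaced-below? S i ∩? ∁? (x ≟_)))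
                                         ≡⟨ count-remove (unplaced-below? S i) (unplaced , below-tight i 1+t<ai tight) ⟨
              backlog S i                ≡⟨ proj₂ tight ⟩
              a i ∸ t                    ≡⟨ +-∸-assoc 1 (proj₁ tight) ⟩
              suc (a i ∸ suc t)          ∎))
          where open ≡-Reasoning
        ... | no  not-tight = s≤s⁻¹ (begin
              suc (backlog extension i)  ≡⟨ cong suc (backlog-drop i) ⟩
              suc (count (unplaced-below? S i ∩? ∁? (x ≟_)))  ≤⟨ s≤s (⊆⇒count≤ _ (unplaced-below? S i) proj₁) ⟩
              suc (backlog S i)          ≤⟨ ≤∧≢⇒< (backlog-bound i t<ai) (λ eq → not-tight (t<ai , eq)) ⟩
              a i ∸ t                    ≡⟨ +-∸-assoc 1 t<ai ⟩
              suc (a i ∸ suc t)          ∎)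
          where
          open ≤-Reasoning
          t<ai : t < a i
          t<ai = <-trans (n<1+n t) 1+t<ai

    schedule : ∀ t → t ≤ n → Σ (PartialExtension t) OnSchedule
    schedule zero    _   = empty , empty-on-schedule
    schedule (suc t) t<n
      with S , on-schedule ← schedule t (<⇒≤ t<n)
      with x , e ← Step.eligible-exists S t<n on-schedule =
      Extension.extension S t<n x (Eligible.unplaced e) (Eligible.ready e) , Step.extend-on-schedule S t<n on-schedule e

    feasible⇒respected : Σ LinearExtension Respects
    feasible⇒respected with S , on-schedule ← schedule n ≤-refl =
      linearExtension , λ i → trans (cong suc (toℕ-position (u i))) (chain-placed i (a≤n i))
      where
      open Completion S
      open OnSchedule on-schedule

theorem1p10 : (n k : ℕ) (P : FinPoset n) →
    let open FinPoset P in
    (u : Fin k → Fin n) → (∀ {i j} → i F.< j → u i ≺ u j) →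
    (a : Fin k → ℕ) → (∀ i → 1 ≤ a i) → (∀ i → a i ≤ n) →
    (∀ {i j} → i F.< j → a i < a j) →
    (Σ LinearExtension λ L → ∀ i → suc (toℕ (LinearExtension.f L (u i))) ≡ a i)
    ⇔ ((∀ i → ℓ (u i) ≤ a i × b (u i) ≤ n ∸ a i + 1)
       × (∀ i j → i F.< j → h (u i) (u j) < a j ∸ a i))
theorem1p10 n k P u u-chain a a-positive a≤n a-mono = mk⇔
  (λ (L , respects) → respects⇒feasible u-chain L respects)
  (Construction.feasible⇒respected u-chain a-positive a≤n a-mono)
  where open Prescription P u a
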